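{- LPO is equivalent to the statement that every metastable, increasing sequence of rational numbers is bounded.
   Context: Work in Bishop-style constructive mathematics: intuitionistic logic with countable and dependent choice; "equivalent" means mutual implication over this base. LPO: for every binary sequence $(a_n)_{n\ge1}$, either $a_n=0$ for all $n$, or there exists $n$ with $a_n=1$. A sequence $(x_n)_{n\ge1}$ in a metric space $(X,d)$ is metastable if for every $\varepsilon>0$ and every function $f:\mathbb{N}\to\mathbb{N}$ there exists $m$ such that $d(x_i,x_j)<\varepsilon$ for all $i,j\in[m,f(m)]$, where $[k,\ell]=\{k,k+1,\dots,\ell\}$. -}

module Defs where

open import Data.Nat using (ℕ; suc) renaming (_≤_ to _≤ℕ_)
open import Data.Bool using (Bool; true; false)
open import Data.Rational using (ℚ; 0ℚ; _<_; _≤_; _-_; ∣_∣)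
open import Data.Product using (Σ; ∃; _×_)
open import Data.Sum using (_⊎_)
open import Relation.Binary.PropositionalEquality using (_≡_)

LPO : Set
LPO = (a : ℕ → Bool) → ((n : ℕ) → a n ≡ false) ⊎ (∃ λ n → a n ≡ true)

Metastable : (ℕ → ℚ) → Set
Metastable x = (ε : ℚ) → 0ℚ < ε → (f : ℕ → ℕ) →
  ∃ λ m → (i j : ℕ) → m ≤ℕ i → i ≤ℕ f m → m ≤ℕ j → j ≤ℕ f m →
    ∣ x i - x j ∣ < ε

Increasing : (ℕ → ℚ) → Set
Increasing x = (n : ℕ) → x n ≤ x (suc n)

Bounded : (ℕ → ℚ) → Set
Bounded x = ∃ λ (B : ℚ) → (n : ℕ) → ∣ x n ∣ ≤ B

MetaIncBounded : Set
MetaIncBounded = (x : ℕ → ℚ) → Metastable x → Increasing x → Bounded x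

module Submission where

-- (⇒) For each m, LPO decides whether x ever rises by more than 1 above
-- x m; let horizon m be m if it never does, and an index where it already
-- has otherwise.  Metastability with ε = 1 and f = horizon gives an m whose
-- window [m, horizon m] contains no such rise, so x n ≤ 1 + x m for all n;
-- with x 0 ≤ x n this bounds |x n|.
--
-- (⇐) For a binary sequence a, firstHit n is 0 while a is false up to n and
-- k + 1 from the first k with a k = true on.  This sequence is increasing and
-- "settling" (hence metastable); a rational bound on it yields, by the
-- Archimedean property, a bound N ∈ ℕ, and firstHit N decides LPO for a.

open import Defs
open import Data.Product using (_×_; _,_; ∃; uncurry)
open import Data.Sum using (_⊎_; inj₁; inj₂)
import Data.Sum as Sum
open import Data.Bool using (Bool; true; false; if_then_else_)
open import Data.Empty using (⊥-elim)
open import Function using (_∘_)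
open import Relation.Nullary using (¬_; Dec; yes; no; does)
open import Relation.Binary.PropositionalEquality
  using (_≡_; _≢_; refl; sym; trans; cong; subst; subst₂)
open import Data.Nat as ℕ using (ℕ; zero; suc; z≤n; _≤′_; ≤′-refl; ≤′-step)
  renaming (_≤_ to _≤ℕ_; _<_ to _<ℕ_)
import Data.Nat.Properties as ℕP
open import Data.Nat.Coprimality using (1-coprimeTo)
import Data.Nat.Coprimality as Coprimality
open import Data.Integer as ℤ using (+_; -[1+_])
import Data.Integer.Properties as ℤP
open import Data.Rational
  using (ℚ; mkℚ; 0ℚ; 1ℚ; _<_; _≤_; _-_; _+_; -_; ∣_∣; _⊔_; *≤*; _<?_)
open import Data.Rational.Properties

true≢false : true ≢ false
true≢false ()

LPO-dec : LPO → {P : ℕ → Set} → ((n : ℕ) → Dec (P n)) →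
          ((n : ℕ) → ¬ P n) ⊎ ∃ P
LPO-dec lpo P? with lpo (does ∘ P?)
... | inj₁ never = inj₁ λ n → refuted (P? n) (never n)
  where
  refuted : ∀ {A : Set} (A? : Dec A) → does A? ≡ false → ¬ A
  refuted (no ¬a) _ = ¬a
... | inj₂ (n , hit) = inj₂ (n , confirmed (P? n) hit)
  where
  confirmed : ∀ {A : Set} (A? : Dec A) → does A? ≡ true → A
  confirmed (yes a) _ = a

propagate : (P : ℕ → Set) → ((n : ℕ) → P n → P (suc n)) →
            ∀ {m n} → m ≤ℕ n → P m → P n
propagate P step m≤n = go (ℕP.≤⇒≤′ m≤n)
  where
  go : ∀ {m n} → m ≤′ n → P m → P n
  go ≤′-refl      pm = pm
  go (≤′-step m≤n) pm = step _ (go m≤n pm)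

increasing-mono : (x : ℕ → ℚ) → Increasing x → ∀ {i j} → i ≤ℕ j → x i ≤ x j
increasing-mono x inc {i} i≤j =
  propagate (λ j → x i ≤ x j) (λ n xi≤xn → ≤-trans xi≤xn (inc n)) i≤j ≤-refl

p≤∣p∣ : ∀ p → p ≤ ∣ p ∣
p≤∣p∣ (mkℚ (+ n) d c)    = ≤-refl
p≤∣p∣ p@(mkℚ -[1+ n ] d c) = ≤-trans (<⇒≤ (negative⁻¹ p)) (0≤∣p∣ p)

∣q∣≤∣L∣⊔∣U∣ : ∀ {L q U} → L ≤ q → q ≤ U → ∣ q ∣ ≤ ∣ L ∣ ⊔ ∣ U ∣
∣q∣≤∣L∣⊔∣U∣ {L} {q} {U} L≤q q≤U with ∣p∣≡p∨∣p∣≡-p q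
... | inj₁ ∣q∣≡q  = subst (_≤ ∣ L ∣ ⊔ ∣ U ∣) (sym ∣q∣≡q)
  (p≤q⇒p≤r⊔q ∣ L ∣ (≤-trans q≤U (p≤∣p∣ U)))
... | inj₂ ∣q∣≡-q = subst (_≤ ∣ L ∣ ⊔ ∣ U ∣) (sym ∣q∣≡-q)
  (p≤q⇒p≤q⊔r ∣ U ∣ (≤-trans (neg-antimono-≤ L≤q)
                     (subst (- L ≤_) (∣-p∣≡∣p∣ L) (p≤∣p∣ (- L)))))

equal⇒close : ∀ {p q ε} → p ≡ q → 0ℚ < ε → ∣ p - q ∣ < ε
equal⇒close {p} refl 0<ε = subst (_< _) (sym (cong ∣_∣ (+-inverseʳ p))) 0<ε

p-q≤r⇒p≤r+q : ∀ {p q r} → p - q ≤ r → p ≤ r + q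
p-q≤r⇒p≤r+q {p} {q} {r} p-q≤r = subst (_≤ r + q) p-q+q≡p (+-monoˡ-≤ q p-q≤r)
  where
  p-q+q≡p : p - q + q ≡ p
  p-q+q≡p = trans (+-assoc p (- q) q)
              (trans (cong (λ t → p + t) (+-inverseˡ q)) (+-identityʳ p))

fromℕ : ℕ → ℚ
fromℕ k = mkℚ (+ k) 0 (Coprimality.sym (1-coprimeTo k))

fromℕ-cancel-≤ : ∀ {m n} → fromℕ m ≤ fromℕ n → m ≤ℕ n
fromℕ-cancel-≤ {m} {n} (*≤* m≤n) =
  ℤP.drop‿+≤+ (subst₂ ℤ._≤_ (ℤP.*-identityʳ (+ m)) (ℤP.*-identityʳ (+ n)) m≤n)

fromℕ-mono-≤ : ∀ {m n} → m ≤ℕ n → fromℕ m ≤ fromℕ n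
fromℕ-mono-≤ {m} {n} m≤n = *≤* (subst₂ ℤ._≤_
  (sym (ℤP.*-identityʳ (+ m))) (sym (ℤP.*-identityʳ (+ n))) (ℤ.+≤+ m≤n))

archimedean : ∀ B → ∃ λ N → B ≤ fromℕ N
archimedean (mkℚ (+ n) d c) = n , *≤* (subst₂ ℤ._≤_
  (sym (ℤP.*-identityʳ (+ n))) (ℤP.pos-* n (suc d)) (ℤ.+≤+ (ℕP.m≤m*n n (suc d))))
archimedean p@(mkℚ -[1+ n ] d c) = 0 , <⇒≤ (negative⁻¹ p)

-- A sequence of naturals which is bounded as a sequence of rationals is
-- bounded by a natural number (note ∣ fromℕ k ∣ is fromℕ k by computation).
ℚ-bounded⇒ℕ-bounded : (h : ℕ → ℕ) → Bounded (fromℕ ∘ h) → ∃ λ N → ∀ n → h n ≤ℕ N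
ℚ-bounded⇒ℕ-bounded h (B , bound) with archimedean B
... | N , B≤N = N , λ n → fromℕ-cancel-≤ (≤-trans (bound n) B≤N)

Settling : {A : Set} → (ℕ → A) → Set
Settling x = ∀ m → (∀ i → i ≤ℕ m → x i ≡ x 0) ⊎ (∀ j → m ≤ℕ j → x j ≡ x m)

settling-map : {A B : Set} (g : A → B) {x : ℕ → A} → Settling x → Settling (g ∘ x)
settling-map g settles m =
  Sum.map (λ still i i≤m → cong g (still i i≤m))
          (λ frozen j m≤j → cong g (frozen j m≤j)) (settles m)

-- Settling sequences are metastable: at m = f 0 either x is constant on
-- [0, f 0] (take the window at 0) or from f 0 on (take the window at f 0).
settling⇒metastable : (x : ℕ → ℚ) → Settling x → Metastable x
settling⇒metastable x settles ε 0<ε f with settles (f 0)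
... | inj₁ still  = 0 , λ i j _ i≤ _ j≤ →
  equal⇒close (trans (still i i≤) (sym (still j j≤))) 0<ε
... | inj₂ frozen = f 0 , λ i j ≤i _ ≤j _ →
  equal⇒close (trans (frozen i ≤i) (sym (frozen j ≤j))) 0<ε

increasing-boundedAbove⇒bounded : (x : ℕ → ℚ) → Increasing x →
  ∀ U → (∀ n → x n ≤ U) → Bounded x
increasing-boundedAbove⇒bounded x inc U below =
  ∣ x 0 ∣ ⊔ ∣ U ∣ , λ n → ∣q∣≤∣L∣⊔∣U∣ (increasing-mono x inc z≤n) (below n)

module _ (lpo : LPO) (x : ℕ → ℚ) (inc : Increasing x) where

  RisesFrom : ℕ → ℕ → Set
  RisesFrom m n = 1ℚ < x n - x m

  rise? : ∀ m → ((n : ℕ) → ¬ RisesFrom m n) ⊎ ∃ (RisesFrom m)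
  rise? m = LPO-dec lpo (λ n → 1ℚ <? x n - x m)

  horizon : ℕ → ℕ
  horizon m with rise? m
  ... | inj₁ _       = m
  ... | inj₂ (n , _) = m ℕ.+ n

  rise-persists : ∀ m n → RisesFrom m n → RisesFrom m (m ℕ.+ n)
  rise-persists m n rise =
    <-≤-trans rise (+-monoˡ-≤ (- x m) (increasing-mono x inc (ℕP.m≤n+m n m)))

  -- The core of (⇒): at the m given by metastability for horizon, a rise
  -- from m would occur inside the window [m, horizon m], which is impossible.
  metastable⇒boundedAbove : Metastable x → ∃ λ U → ∀ n → x n ≤ U
  metastable⇒boundedAbove ms with ms 1ℚ (positive⁻¹ 1ℚ) horizon
  ... | m , window with rise? m
  ...   | inj₁ never      = 1ℚ + x m , λ n → p-q≤r⇒p≤r+q (≮⇒≥ (never n))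
  ...   | inj₂ (n , rise) = ⊥-elim (<-asym small (<-≤-trans large (p≤∣p∣ _)))
    where
    small : ∣ x (m ℕ.+ n) - x m ∣ < 1ℚ
    small = window (m ℕ.+ n) m (ℕP.m≤m+n m n) ℕP.≤-refl ℕP.≤-refl (ℕP.m≤m+n m n)
    large : 1ℚ < x (m ℕ.+ n) - x m
    large = rise-persists m n rise

LPO⇒MetaIncBounded : LPO → MetaIncBounded
LPO⇒MetaIncBounded lpo x ms inc with metastable⇒boundedAbove lpo x inc ms
... | U , below = increasing-boundedAbove⇒bounded x inc U below

module FirstHit (a : ℕ → Bool) where

  fresh : ℕ → ℕ
  fresh n = if a n then suc n else 0

  keep : ℕ → ℕ → ℕ
  keep zero    s = s
  keep (suc k) _ = suc k

  -- firstHit n = 0 if a i = false for all i ≤ n, and k + 1 for the least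
  -- k ≤ n with a k = true otherwise.
  firstHit : ℕ → ℕ
  firstHit zero    = fresh 0
  firstHit (suc n) = keep (firstHit n) (fresh (suc n))

  fresh-sound : ∀ n {k} → fresh n ≡ suc k → a k ≡ true
  fresh-sound n e with a n in an
  fresh-sound n refl | true = an

  fresh-zero : ∀ n → fresh n ≡ 0 → a n ≡ false
  fresh-zero n e with a n in an
  ... | false = refl

  firstHit-step : ∀ n → firstHit n ≤ℕ firstHit (suc n)
  firstHit-step n with firstHit n
  ... | zero  = z≤n
  ... | suc k = ℕP.≤-refl

  firstHit-mono : ∀ {i j} → i ≤ℕ j → firstHit i ≤ℕ firstHit j
  firstHit-mono {i} i≤j =
    propagate (λ j → firstHit i ≤ℕ firstHit j)
              (λ n i≤n → ℕP.≤-trans i≤n (firstHit-step n)) i≤j ℕP.≤-refl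

  firstHit-frozen : ∀ {m n k} → m ≤ℕ n → firstHit m ≡ suc k → firstHit n ≡ suc k
  firstHit-frozen {k = k} = propagate (λ n → firstHit n ≡ suc k) freeze
    where
    freeze : ∀ n → firstHit n ≡ suc k → firstHit (suc n) ≡ suc k
    freeze n e rewrite e = refl

  firstHit-sound : ∀ n {k} → firstHit n ≡ suc k → a k ≡ true
  firstHit-sound zero    e = fresh-sound 0 e
  firstHit-sound (suc n) e with firstHit n in hn
  ... | zero  = fresh-sound (suc n) e
  ... | suc _ = firstHit-sound n (trans hn e)

  firstHit-none : ∀ n → firstHit n ≡ 0 → ∀ {i} → i ≤ℕ n → a i ≡ false
  firstHit-none zero    e z≤n = fresh-zero 0 e
  firstHit-none (suc n) e i≤ with firstHit n in hn
  ... | zero with ℕP.m≤n⇒m<n∨m≡n i≤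
  ...   | inj₁ i<1+n = firstHit-none n hn (ℕP.≤-pred i<1+n)
  ...   | inj₂ refl  = fresh-zero (suc n) e

  late-hit : ∀ {N j} → firstHit N ≡ 0 → a j ≡ true → N <ℕ firstHit j
  late-hit {N} {j} none aj with firstHit j in hj
  ... | zero  = ⊥-elim (true≢false (trans (sym aj) (firstHit-none j hj ℕP.≤-refl)))
  ... | suc k = ℕP.m<n⇒m<1+n (ℕP.≰⇒> k≰N)
    where
    k≰N : ¬ k ≤ℕ N
    k≰N k≤N = true≢false (trans (sym (firstHit-sound j hj)) (firstHit-none N none k≤N))

  firstHit-settles : Settling firstHit
  firstHit-settles m with firstHit m in hm
  ... | zero  = inj₁ λ i i≤m → trans (vanishes i≤m) (sym (vanishes z≤n))
    where
    vanishes : ∀ {i} → i ≤ℕ m → firstHit i ≡ 0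
    vanishes i≤m = ℕP.n≤0⇒n≡0 (subst (_ ≤ℕ_) hm (firstHit-mono i≤m))
  ... | suc k = inj₂ λ j m≤j → firstHit-frozen m≤j hm

  bounded⇒decides : ∀ N → (∀ n → firstHit n ≤ℕ N) →
                    ((n : ℕ) → a n ≡ false) ⊎ (∃ λ n → a n ≡ true)
  bounded⇒decides N bound with firstHit N in hN
  ... | suc k = inj₂ (k , firstHit-sound N hN)
  ... | zero  = inj₁ never
    where
    never : ∀ j → a j ≡ false
    never j with a j in aj
    ... | false = refl
    ... | true  = ⊥-elim (ℕP.<⇒≱ (late-hit hN aj) (bound j))

MetaIncBounded⇒LPO : MetaIncBounded → LPO
MetaIncBounded⇒LPO mib a =
  uncurry bounded⇒decides (ℚ-bounded⇒ℕ-bounded firstHit (mib x metastable increasing))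
  where
  open FirstHit a
  x : ℕ → ℚ
  x = fromℕ ∘ firstHit
  metastable : Metastable x
  metastable = settling⇒metastable x (settling-map fromℕ firstHit-settles)
  increasing : Increasing x
  increasing n = fromℕ-mono-≤ (firstHit-step n)

proposition1p2p6 : (LPO → MetaIncBounded) × (MetaIncBounded → LPO)
proposition1p2p6 = LPO⇒MetaIncBounded , MetaIncBounded⇒LPO
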